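{- Let $m$ and $n$ be positive integers with $n>1$. The number of cliques of order $m$ (sets of $m$ pairwise adjacent vertices) in the graph $G_{\mathbb{Z}/(n)}$ is $\prod_{k=1}^m\frac{S_{k-1}(n)}{k}$.
   Context: $G_{\mathbb{Z}/(n)}$ has vertex set $\mathbb{Z}/(n)$, with $a,b$ adjacent iff $a-b$ is a unit of $\mathbb{Z}/(n)$. $S_0(n)=n$, and for a positive integer $r$, the Schemmel totient $S_r(n)$ is the number of positive integers $k\le n$ with $\gcd(k+i,n)=1$ for all $i\in\{0,1,\ldots,r-1\}$; equivalently $S_r$ is multiplicative with $S_r(p^\alpha)=0$ if $p\le r$ and $S_r(p^\alpha)=p^{\alpha-1}(p-r)$ if $p>r$, for primes $p$ and positive integers $\alpha$. -}

module Defs where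

open import Data.Nat using (ℕ; zero; suc; _+_; _*_; _∸_; NonZero; _≟_)
open import Data.Nat.DivMod using (_%_)
open import Data.Nat.GCD using (gcd)
open import Data.Fin using (Fin; toℕ)
import Data.Fin as F
open import Data.Fin.Properties using (any?; all?)
open import Data.Fin.Subset using (Subset; _∈_; ∣_∣)
open import Data.Fin.Subset.Properties using (_∈?_)
open import Data.List using (List; []; _∷_; map; _++_; length; filter; upTo)
open import Data.Vec using ([]; _∷_)
open import Data.Bool using (true; false)
open import Data.Product using (Σ; _,_)
open import Data.Integer using (+_)
open import Data.Rational using (ℚ; _/_; 1ℚ) renaming (_*_ to _*ℚ_)
open import Relation.Binary.PropositionalEquality using (_≡_)
open import Relation.Nullary using (Dec; ¬_; ¬?)
open import Relation.Nullary.Decidable using (_→-dec_)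

IsUnit : (n : ℕ) .{{_ : NonZero n}} → ℕ → Set
IsUnit n d = Σ (Fin n) λ c → (d * toℕ c) % n ≡ 1 % n

isUnit? : (n : ℕ) .{{_ : NonZero n}} (d : ℕ) → Dec (IsUnit n d)
isUnit? n d = any? (λ c → ((d * toℕ c) % n) ≟ (1 % n))

diffMod : (n : ℕ) .{{_ : NonZero n}} → Fin n → Fin n → ℕ
diffMod n a b = (toℕ a + (n ∸ toℕ b)) % n

Adj : (n : ℕ) .{{_ : NonZero n}} → Fin n → Fin n → Set
Adj n a b = IsUnit n (diffMod n a b)

IsClique : (n : ℕ) .{{_ : NonZero n}} → Subset n → Set
IsClique n s = ∀ i j → ¬ (i ≡ j) → i ∈ s → j ∈ s → Adj n i j

isClique? : (n : ℕ) .{{_ : NonZero n}} (s : Subset n) → Dec (IsClique n s)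
isClique? n s = all? λ i → all? λ j →
  ¬? (i F.≟ j) →-dec ((i ∈? s) →-dec ((j ∈? s) →-dec isUnit? n (diffMod n i j)))

IsCliqueOfOrder : (n : ℕ) .{{_ : NonZero n}} → ℕ → Subset n → Set
IsCliqueOfOrder n m s = (∣ s ∣ ≡ m) Data.Product.× IsClique n s
  where import Data.Product

isCliqueOfOrder? : (n : ℕ) .{{_ : NonZero n}} (m : ℕ) (s : Subset n) → Dec (IsCliqueOfOrder n m s)
isCliqueOfOrder? n m s = (∣ s ∣ ≟ m) ×-dec isClique? n s
  where open import Relation.Nullary.Decidable using (_×-dec_)

allSubsets : (n : ℕ) → List (Subset n)
allSubsets zero = [] ∷ []
allSubsets (suc n) = map (false ∷_) (allSubsets n) ++ map (true ∷_) (allSubsets n)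

numCliques : (n : ℕ) .{{_ : NonZero n}} → ℕ → ℕ
numCliques n m = length (filter (isCliqueOfOrder? n m) (allSubsets n))

schemmel : ℕ → ℕ → ℕ
schemmel r n = length (filter (λ k → all? {n = r} λ i → gcd (k + toℕ i) n ≟ 1)
                              (map suc (upTo n)))

schemmelProduct : ℕ → ℕ → ℚ
schemmelProduct zero n = 1ℚ
schemmelProduct (suc m) n = schemmelProduct m n *ℚ ((+ schemmel m n) / suc m)

-- Double counting pairs (clique, vertex) gives (m + 1) C(m + 1) = C(m) N(m), where C(m) is the number
-- of m-cliques and N(m) the number of common neighbours of an m-clique, provided the latter does not
-- depend on the clique.  A vertex y is a common neighbour of {c₁, …, cₘ} iff every y − cᵢ is coprime
-- to n, so N counts the y mod n with y + l coprime to n for all l in the list L = (−c₁, …, −cₘ).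
-- This count is multiplicative in n (Chinese remainder theorem), gains a factor p when n is
-- multiplied by a prime p already dividing it, and equals p − m at a prime p if the shifts in L are
-- pairwise incongruent mod p; so it is determined by its values at the primes dividing n.  The
-- elements of a clique are pairwise incongruent modulo every prime divisor p of n (their differences
-- are units), and so are the shifts 0, 1, …, m − 1 defining Sₘ(n) when m ≤ p, while for m > p both
-- counts vanish at p.  Hence N(m) = Sₘ(n).

module Submission where

open import Defs
  using (IsUnit; Adj; diffMod; isUnit?; isCliqueOfOrder?; numCliques; allSubsets; schemmel; schemmelProduct)

open import Data.Bool using (true; false; not; if_then_else_)
open import Data.Empty using (⊥-elim)
open import Data.Fin using (Fin; zero; suc; toℕ; fromℕ<; punchIn)
import Data.Fin.Properties as Fin
open import Data.Fin.Properties using (toℕ-fromℕ<; toℕ<n; toℕ-injective; punchInᵢ≢i)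
open import Data.Fin.Subset using (Subset; _∈_; _∉_; ∣_∣)
open import Data.Fin.Subset.Properties using (_∈?_)
open import Data.List using (List; []; _∷_; _++_; length; map; filter; applyUpTo; upTo)
open import Data.List.Properties using (length-map; length-upTo; map-++; map-∘; map-applyUpTo)
open import Data.List.Membership.Propositional.Properties using (∈-upTo⁺)
open import Data.List.Relation.Unary.All as All using (All; []; _∷_; all?)
import Data.List.Relation.Unary.All.Properties as All
open import Data.List.Relation.Unary.AllPairs using (AllPairs; []; _∷_)
import Data.List.Relation.Unary.AllPairs.Properties as AllPairs
open import Data.Nat
  using (ℕ; zero; suc; pred; _+_; _*_; _∸_; _≤_; _<_; NonZero; nonTrivial⇒≢1)
open import Data.Nat.Properties
open import Algebra.Properties.CommutativeSemigroup +-commutativeSemigroup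
  using (x∙yz≈y∙xz; xy∙z≈y∙xz; xy∙z≈xz∙y; xy∙z≈zy∙x)
open import Algebra.Properties.Semiring.Sum +-*-semiring
  using (sum-syntax; sum-cong-≗; sum-remove; ∑-comm; ∑-distrib-+; *-distribˡ-sum; *-distribʳ-sum)
open import Data.Nat.Coprimality
  using (Coprime; coprime?; gcd≡1⇒coprime; coprime⇒gcd≡1; coprime-Bézout; coprime-divisor; 1-coprimeTo)
  renaming (sym to coprime-sym)
open import Data.Nat.Divisibility
open import Data.Nat.DivMod using (_%_; m≡m%n+[m/n]*n; m%n<n; m%n%n≡m%n; %-distribˡ-*; [m+kn]%n≡m%n)
  renaming (_/_ to _div_)
open import Data.Nat.GCD using (gcd; module Bézout)
open import Data.Nat.ListAction using (sum; product)
open import Data.Nat.ListAction.Properties using (sum-++)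
open import Data.Nat.Primality using (Prime; prime⇒irreducible; prime⇒nonZero; prime⇒nonTrivial)
open import Data.Nat.Primality.Factorisation using (factorise; PrimeFactorisation)
open import Data.Nat.Tactic.RingSolver using (solve-∀)
open import Data.Product using (_×_; _,_; proj₁; proj₂; Σ-syntax)
open import Data.Sum using (inj₁; inj₂)
open import Data.Vec using ([]; _∷_; here; there)
open import Function using (_∘_)
open import Relation.Binary.PropositionalEquality
open import Relation.Nullary using (Dec; does; yes; no; ¬_)
open import Relation.Nullary.Decidable using (_→-dec_)
open import Relation.Unary using (Decidable)

𝟙 : ∀ {p} {P : Set p} → Dec P → ℕ
𝟙 P? = if does P? then 1 else 0

𝟙-yes : ∀ {p} {P : Set p} (P? : Dec P) → P → 𝟙 P? ≡ 1
𝟙-yes (yes _) _ = refl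
𝟙-yes (no ¬p) p = ⊥-elim (¬p p)

𝟙-no : ∀ {p} {P : Set p} (P? : Dec P) → ¬ P → 𝟙 P? ≡ 0
𝟙-no (yes p) ¬p = ⊥-elim (¬p p)
𝟙-no (no _)  _  = refl

𝟙-cong : ∀ {p q} {P : Set p} {Q : Set q} (P? : Dec P) (Q? : Dec Q) →
         (P → Q) → (Q → P) → 𝟙 P? ≡ 𝟙 Q?
𝟙-cong (yes _) (yes _) _   _   = refl
𝟙-cong (yes p) (no ¬q) p⇒q _   = ⊥-elim (¬q (p⇒q p))
𝟙-cong (no ¬p) (yes q) _   q⇒p = ⊥-elim (¬p (q⇒p q))
𝟙-cong (no _)  (no _)  _   _   = refl

𝟙-× : ∀ {p q r} {P : Set p} {Q : Set q} {R : Set r} (P? : Dec P) (Q? : Dec Q) (R? : Dec R) →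
      (R → P × Q) → (P → Q → R) → 𝟙 R? ≡ 𝟙 P? * 𝟙 Q?
𝟙-× (yes p) (yes q) R? _    pq⇒r = 𝟙-cong R? (yes p) (λ _ → p) (λ _ → pq⇒r p q)
𝟙-× (yes _) (no ¬q) R? r⇒pq _    = 𝟙-cong R? (no ¬q) (proj₂ ∘ r⇒pq) (⊥-elim ∘ ¬q)
𝟙-× (no ¬p) Q?      R? r⇒pq _    = 𝟙-cong R? (no ¬p) (proj₁ ∘ r⇒pq) (⊥-elim ∘ ¬p)

length-filter : ∀ {a p} {A : Set a} {P : A → Set p} (P? : Decidable P) xs →
                length (filter P? xs) ≡ sum (map (𝟙 ∘ P?) xs)
length-filter P? []       = refl
length-filter P? (x ∷ xs) with does (P? x)
... | true  = cong suc (length-filter P? xs)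
... | false = length-filter P? xs

Σ< : ℕ → (ℕ → ℕ) → ℕ
Σ< n f = ∑[ i < n ] f (toℕ i)

sum-applyUpTo : ∀ f n → sum (applyUpTo f n) ≡ Σ< n f
sum-applyUpTo f zero    = refl
sum-applyUpTo f (suc n) = cong (f 0 +_) (sum-applyUpTo (f ∘ suc) n)

Σ<-cong : ∀ n {f g : ℕ → ℕ} → (∀ y → f y ≡ g y) → Σ< n f ≡ Σ< n g
Σ<-cong n f≗g = sum-cong-≗ {n} (f≗g ∘ toℕ)

Σ<-const : ∀ n k → Σ< n (λ _ → k) ≡ n * k
Σ<-const zero    k = refl
Σ<-const (suc n) k = cong (k +_) (Σ<-const n k)

Σ<-*ˡ : ∀ n k (f : ℕ → ℕ) → k * Σ< n f ≡ Σ< n (λ y → k * f y)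
Σ<-*ˡ n k f = *-distribˡ-sum {n} k (f ∘ toℕ)

Σ<-*ʳ : ∀ n k (f : ℕ → ℕ) → Σ< n f * k ≡ Σ< n (λ y → f y * k)
Σ<-*ʳ n k f = *-distribʳ-sum {n} k (f ∘ toℕ)

Σ<-comm : ∀ m n (h : ℕ → ℕ → ℕ) → Σ< m (λ t → Σ< n (h t)) ≡ Σ< n (λ u → Σ< m (λ t → h t u))
Σ<-comm m n h = ∑-comm {m} {n} (λ i j → h (toℕ i) (toℕ j))

Σ<-+ : ∀ a b (f : ℕ → ℕ) → Σ< (a + b) f ≡ Σ< a f + Σ< b (λ y → f (a + y))
Σ<-+ zero    b f = refl
Σ<-+ (suc a) b f = trans (cong (f 0 +_) (Σ<-+ a b (f ∘ suc))) (sym (+-assoc (f 0) _ _))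

Σ<-* : ∀ k a (f : ℕ → ℕ) → Σ< (k * a) f ≡ Σ< k (λ t → Σ< a (λ u → f (t * a + u)))
Σ<-* zero    a f = refl
Σ<-* (suc k) a f = begin
  Σ< (a + k * a) f                                        ≡⟨ Σ<-+ a (k * a) f ⟩
  Σ< a f + Σ< (k * a) (λ y → f (a + y))                   ≡⟨ cong (Σ< a f +_) (Σ<-* k a (λ y → f (a + y))) ⟩
  Σ< a f + Σ< k (λ t → Σ< a (λ u → f (a + (t * a + u))))  ≡⟨ cong (Σ< a f +_) (Σ<-cong k λ t →
                                                               Σ<-cong a λ u → cong f (+-assoc a (t * a) u)) ⟨
  Σ< a f + Σ< k (λ t → Σ< a (λ u → f (suc t * a + u)))    ∎
  where open ≡-Reasoning

Σ<-agree-except : ∀ {n f g} (u : Fin n) → (∀ i → i ≢ u → f (toℕ i) ≡ g (toℕ i)) →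
                  Σ< n f + g (toℕ u) ≡ Σ< n g + f (toℕ u)
Σ<-agree-except {suc n} {f} {g} u agree = begin
  Σ< (suc n) f + g (toℕ u)        ≡⟨ cong (_+ g (toℕ u)) (sum-remove {i = u} (f ∘ toℕ)) ⟩
  f (toℕ u) + rest f + g (toℕ u)  ≡⟨ cong (λ r → f (toℕ u) + r + g (toℕ u)) (sum-cong-≗ {n} λ j →
                                       agree (punchIn u j) (punchInᵢ≢i u j)) ⟩
  f (toℕ u) + rest g + g (toℕ u)  ≡⟨ xy∙z≈zy∙x (f (toℕ u)) (rest g) (g (toℕ u)) ⟩
  g (toℕ u) + rest g + f (toℕ u)  ≡⟨ cong (_+ f (toℕ u)) (sum-remove {i = u} (g ∘ toℕ)) ⟨
  Σ< (suc n) g + f (toℕ u)        ∎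
  where
  open ≡-Reasoning
  rest : (ℕ → ℕ) → ℕ
  rest h = ∑[ j < n ] h (toℕ (punchIn u j))

Periodic : ℕ → (ℕ → ℕ) → Set
Periodic a f = ∀ y → f (a + y) ≡ f y

periodic-* : ∀ {a f} → Periodic a f → ∀ k y → f (k * a + y) ≡ f y
periodic-*         per zero    y = refl
periodic-* {a} {f} per (suc k) y = trans (cong f (+-assoc a (k * a) y)) (trans (per _) (periodic-* per k y))

Σ<-periodic : ∀ {a f} → Periodic a f → ∀ k → Σ< (k * a) f ≡ k * Σ< a f
Σ<-periodic {a} {f} per k = begin
  Σ< (k * a) f                              ≡⟨ Σ<-* k a f ⟩
  Σ< k (λ t → Σ< a (λ u → f (t * a + u)))   ≡⟨ Σ<-cong k (λ t → Σ<-cong a (periodic-* per t)) ⟩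
  Σ< k (λ _ → Σ< a f)                       ≡⟨ Σ<-const k (Σ< a f) ⟩
  k * Σ< a f                                ∎
  where open ≡-Reasoning

Σ<-rotate : ∀ {n f} → Periodic n f → Σ< n (f ∘ suc) ≡ Σ< n f
Σ<-rotate {n} {f} per = +-cancelˡ-≡ (f 0) _ _ (begin
  Σ< (suc n) f              ≡⟨ cong (λ k → Σ< k f) (+-comm 1 n) ⟩
  Σ< (n + 1) f              ≡⟨ Σ<-+ n 1 f ⟩
  Σ< n f + (f (n + 0) + 0)  ≡⟨ cong (Σ< n f +_) (trans (+-identityʳ _) (per 0)) ⟩
  Σ< n f + f 0              ≡⟨ +-comm _ (f 0) ⟩
  f 0 + Σ< n f              ∎)
  where open ≡-Reasoning

coprime-periods⇒constant : ∀ {a b g} → Coprime a b → Periodic a g → Periodic b g → ∀ u → g u ≡ g 0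
coprime-periods⇒constant {a} {b} {g} coprime a-per b-per = constant
  where
  open ≡-Reasoning
  step : ∀ u → g (suc u) ≡ g u
  step u with coprime-Bézout coprime
  ... | Bézout.+- x y 1+yb≡xa = begin
    g (suc u)          ≡⟨ periodic-* b-per y (suc u) ⟨
    g (y * b + suc u)  ≡⟨ cong g (trans (+-suc (y * b) u) (cong (_+ u) 1+yb≡xa)) ⟩
    g (x * a + u)      ≡⟨ periodic-* a-per x u ⟩
    g u                ∎
  ... | Bézout.-+ x y 1+xa≡yb = begin
    g (suc u)          ≡⟨ periodic-* a-per x (suc u) ⟨
    g (x * a + suc u)  ≡⟨ cong g (trans (+-suc (x * a) u) (cong (_+ u) 1+xa≡yb)) ⟩
    g (y * b + u)      ≡⟨ periodic-* b-per y u ⟩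
    g u                ∎
  constant : ∀ u → g u ≡ g 0
  constant zero    = refl
  constant (suc u) = trans (step u) (constant u)

-- Summing by residues mod a, the inner sums progressionSum u are a- and b-periodic in u, hence constant.
module _ {a b : ℕ} {A B : ℕ → ℕ} (coprime : Coprime a b) (A-per : Periodic a A) (B-per : Periodic b B) where

  private
    progressionSum : ℕ → ℕ
    progressionSum u = Σ< b (λ t → B (t * a + u))

    progressionSum-per-b : Periodic b progressionSum
    progressionSum-per-b u = Σ<-cong b λ t → trans (cong B (x∙yz≈y∙xz (t * a) b u)) (B-per (t * a + u))

    progressionSum-per-a : Periodic a progressionSum
    progressionSum-per-a u = trans (Σ<-cong b (λ t → cong B (shift t))) (Σ<-rotate {b} {h} h-per)
      where
      h : ℕ → ℕ
      h t = B (t * a + u)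
      shift : ∀ t → t * a + (a + u) ≡ suc t * a + u
      shift t = trans (sym (+-assoc (t * a) a u)) (cong (_+ u) (+-comm (t * a) a))
      rearrange : ∀ b t a u → (b + t) * a + u ≡ a * b + (t * a + u)
      rearrange = solve-∀
      h-per : Periodic b h
      h-per t = trans (cong B (rearrange b t a u)) (periodic-* B-per a (t * a + u))

    progressionSum-const : ∀ u → progressionSum u ≡ progressionSum 0
    progressionSum-const = coprime-periods⇒constant coprime progressionSum-per-a progressionSum-per-b

    progressionSum0 : .{{_ : NonZero a}} → progressionSum 0 ≡ Σ< b B
    progressionSum0 = *-cancelˡ-≡ _ _ a (begin
      a * progressionSum 0                     ≡⟨ Σ<-const a (progressionSum 0) ⟨
      Σ< a (λ _ → progressionSum 0)            ≡⟨ Σ<-cong a progressionSum-const ⟨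
      Σ< a progressionSum                      ≡⟨ Σ<-comm a b (λ u t → B (t * a + u)) ⟩
      Σ< b (λ t → Σ< a (λ u → B (t * a + u)))  ≡⟨ Σ<-* b a B ⟨
      Σ< (b * a) B                             ≡⟨ cong (λ k → Σ< k B) (*-comm b a) ⟩
      Σ< (a * b) B                             ≡⟨ Σ<-periodic B-per a ⟩
      a * Σ< b B                               ∎)
      where open ≡-Reasoning

  Σ<-*-coprime : .{{_ : NonZero a}} → Σ< (a * b) (λ y → A y * B y) ≡ Σ< a A * Σ< b B
  Σ<-*-coprime = begin
    Σ< (a * b) (λ y → A y * B y)
      ≡⟨ cong (λ k → Σ< k (λ y → A y * B y)) (*-comm a b) ⟩
    Σ< (b * a) (λ y → A y * B y)
      ≡⟨ Σ<-* b a (λ y → A y * B y) ⟩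
    Σ< b (λ t → Σ< a (λ u → A (t * a + u) * B (t * a + u)))
      ≡⟨ Σ<-cong b (λ t → Σ<-cong a λ u → cong (_* B (t * a + u)) (periodic-* A-per t u)) ⟩
    Σ< b (λ t → Σ< a (λ u → A u * B (t * a + u)))
      ≡⟨ Σ<-comm b a (λ t u → A u * B (t * a + u)) ⟩
    Σ< a (λ u → Σ< b (λ t → A u * B (t * a + u)))
      ≡⟨ Σ<-cong a (λ u → Σ<-*ˡ b (A u) (λ t → B (t * a + u))) ⟨
    Σ< a (λ u → A u * progressionSum u)
      ≡⟨ Σ<-cong a (λ u → cong (A u *_) (progressionSum-const u)) ⟩
    Σ< a (λ u → A u * progressionSum 0)
      ≡⟨ Σ<-*ʳ a (progressionSum 0) A ⟨
    Σ< a A * progressionSum 0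
      ≡⟨ cong (Σ< a A *_) progressionSum0 ⟩
    Σ< a A * Σ< b B
      ∎
    where open ≡-Reasoning

coprime-*ʳ⁻ : ∀ {z a b} → Coprime z (a * b) → Coprime z a × Coprime z b
coprime-*ʳ⁻ {a = a} {b} c = (λ (d∣z , d∣a) → c (d∣z , ∣m⇒∣m*n b d∣a))
                          , (λ (d∣z , d∣b) → c (d∣z , ∣n⇒∣m*n a d∣b))

coprime-*ʳ⁺ : ∀ {z a b} → Coprime z a → Coprime z b → Coprime z (a * b)
coprime-*ʳ⁺ {z} {a} ca cb {d} (d∣z , d∣ab) = cb (d∣z , coprime-divisor d⊥a d∣ab)
  where
  d⊥a : Coprime d a
  d⊥a (e∣d , e∣a) = ca (∣-trans e∣d d∣z , e∣a)

coprime-∣ʳ : ∀ {z a b} → a ∣ b → Coprime z b → Coprime z a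
coprime-∣ʳ a∣b c (d∣z , d∣a) = c (d∣z , ∣-trans d∣a a∣b)

coprime-prime⇒∤ : ∀ {z p} → Prime p → Coprime z p → ¬ p ∣ z
coprime-prime⇒∤ p-prime c p∣z = nonTrivial⇒≢1 {{prime⇒nonTrivial p-prime}} (c (p∣z , ∣-refl))

∤-prime⇒coprime : ∀ {z p} → Prime p → ¬ p ∣ z → Coprime z p
∤-prime⇒coprime p-prime p∤z (d∣z , d∣p) with prime⇒irreducible p-prime d∣p
... | inj₁ d≡1  = d≡1
... | inj₂ refl = ⊥-elim (p∤z d∣z)

CoprimeShifts : ℕ → List ℕ → ℕ → Set
CoprimeShifts n L y = All (λ l → Coprime (y + l) n) L

coprimeShifts? : ∀ n L y → Dec (CoprimeShifts n L y)
coprimeShifts? n L y = all? (λ l → coprime? (y + l) n) L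

shiftTotient : List ℕ → ℕ → ℕ
shiftTotient L n = Σ< n (λ y → 𝟙 (coprimeShifts? n L y))

coprimeShifts-periodic : ∀ n L → Periodic n (λ y → 𝟙 (coprimeShifts? n L y))
coprimeShifts-periodic n L y =
  𝟙-cong (coprimeShifts? n L (n + y)) (coprimeShifts? n L y) (All.map unshift) (All.map shift)
  where
  unshift : ∀ {l} → Coprime (n + y + l) n → Coprime (y + l) n
  unshift {l} c {d} (d∣y+l , d∣n) = c (subst (d ∣_) (sym (+-assoc n y l)) (∣m∣n⇒∣m+n d∣n d∣y+l) , d∣n)
  shift : ∀ {l} → Coprime (y + l) n → Coprime (n + y + l) n
  shift {l} c {d} (d∣n+y+l , d∣n) = c (∣m+n∣m⇒∣n (subst (d ∣_) (+-assoc n y l) d∣n+y+l) d∣n , d∣n)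

coprimeShifts-* : ∀ a b L y →
  𝟙 (coprimeShifts? (a * b) L y) ≡ 𝟙 (coprimeShifts? a L y) * 𝟙 (coprimeShifts? b L y)
coprimeShifts-* a b L y = 𝟙-× (coprimeShifts? a L y) (coprimeShifts? b L y) (coprimeShifts? (a * b) L y)
  (All.unzip ∘ All.map split) (λ ca cb → All.zipWith join (ca , cb))
  where
  split : ∀ {l} → Coprime (y + l) (a * b) → Coprime (y + l) a × Coprime (y + l) b
  split = coprime-*ʳ⁻
  join : ∀ {l} → Coprime (y + l) a × Coprime (y + l) b → Coprime (y + l) (a * b)
  join (ca , cb) = coprime-*ʳ⁺ ca cb

coprimeShifts-∣ : ∀ {p b} L y → p ∣ b → 𝟙 (coprimeShifts? (p * b) L y) ≡ 𝟙 (coprimeShifts? b L y)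
coprimeShifts-∣ {p} {b} L y p∣b =
  𝟙-cong (coprimeShifts? (p * b) L y) (coprimeShifts? b L y) (All.map drop) (All.map add)
  where
  drop : ∀ {l} → Coprime (y + l) (p * b) → Coprime (y + l) b
  drop c = proj₂ (coprime-*ʳ⁻ {a = p} c)
  add : ∀ {l} → Coprime (y + l) b → Coprime (y + l) (p * b)
  add c = coprime-*ʳ⁺ (coprime-∣ʳ p∣b c) c

coprimeShifts-∷ : ∀ n l L y →
  𝟙 (coprimeShifts? n (l ∷ L) y) ≡ 𝟙 (coprime? (y + l) n) * 𝟙 (coprimeShifts? n L y)
coprimeShifts-∷ n l L y = 𝟙-× (coprime? (y + l) n) (coprimeShifts? n L y) (coprimeShifts? n (l ∷ L) y)
  (λ { (c ∷ cs) → c , cs }) _∷_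

shiftTotient-1 : ∀ L → shiftTotient L 1 ≡ 1
shiftTotient-1 L = trans (+-identityʳ _) (𝟙-yes (coprimeShifts? 1 L 0) (All.universal coprimeTo1 L))
  where
  coprimeTo1 : ∀ z → Coprime z 1
  coprimeTo1 z = coprime-sym (1-coprimeTo z)

shiftTotient-*-coprime : ∀ {a b} .{{_ : NonZero a}} L → Coprime a b →
                         shiftTotient L (a * b) ≡ shiftTotient L a * shiftTotient L b
shiftTotient-*-coprime {a} {b} L coprime =
  trans (Σ<-cong (a * b) (coprimeShifts-* a b L))
        (Σ<-*-coprime coprime (coprimeShifts-periodic a L) (coprimeShifts-periodic b L))

shiftTotient-*-∣ : ∀ {p b} L → p ∣ b → shiftTotient L (p * b) ≡ p * shiftTotient L b
shiftTotient-*-∣ {p} {b} L p∣b =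
  trans (Σ<-cong (p * b) (λ y → coprimeShifts-∣ L y p∣b)) (Σ<-periodic (coprimeShifts-periodic b L) p)

record TotientLike (f : ℕ → ℕ) : Set where
  field
    f-1         : f 1 ≡ 1
    f-*-coprime : ∀ {p b} → Prime p → ¬ p ∣ b → f (p * b) ≡ f p * f b
    f-*-∣       : ∀ {p b} → p ∣ b → f (p * b) ≡ p * f b

totientLike-unique : ∀ {f g} → TotientLike f → TotientLike g → ∀ n .{{_ : NonZero n}} →
                     (∀ p → Prime p → p ∣ n → f p ≡ g p) → f n ≡ g n
totientLike-unique {f} {g} F G n agree = begin
  f n             ≡⟨ cong f isFactorisation ⟩
  f (product ps)  ≡⟨ onProducts ps factorsPrime (λ p pr → agree p pr ∘ subst (p ∣_) (sym isFactorisation)) ⟩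
  g (product ps)  ≡⟨ cong g isFactorisation ⟨
  g n             ∎
  where
  open ≡-Reasoning
  open PrimeFactorisation (factorise n) renaming (factors to ps)
  module F = TotientLike F
  module G = TotientLike G
  onProducts : ∀ qs → All Prime qs → (∀ p → Prime p → p ∣ product qs → f p ≡ g p) →
               f (product qs) ≡ g (product qs)
  onProducts []       _                        _     = trans F.f-1 (sym G.f-1)
  onProducts (q ∷ qs) (q-prime ∷ qs-prime) agree
    with q ∣? product qs | onProducts qs qs-prime (λ p pr → agree p pr ∘ ∣n⇒∣m*n q)
  ... | yes q∣qs | ih = begin
    f (q * product qs)    ≡⟨ F.f-*-∣ q∣qs ⟩
    q * f (product qs)    ≡⟨ cong (q *_) ih ⟩
    q * g (product qs)    ≡⟨ G.f-*-∣ q∣qs ⟨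
    g (q * product qs)    ∎
  ... | no q∤qs  | ih = begin
    f (q * product qs)    ≡⟨ F.f-*-coprime q-prime q∤qs ⟩
    f q * f (product qs)  ≡⟨ cong₂ _*_ (agree q q-prime (∣m⇒∣m*n (product qs) ∣-refl)) ih ⟩
    g q * g (product qs)  ≡⟨ G.f-*-coprime q-prime q∤qs ⟨
    g (q * product qs)    ∎

shiftTotient-totientLike : ∀ L → TotientLike (shiftTotient L)
shiftTotient-totientLike L = record
  { f-1         = shiftTotient-1 L
  ; f-*-coprime = λ p-prime p∤b →
      shiftTotient-*-coprime {{prime⇒nonZero p-prime}} L (coprime-sym (∤-prime⇒coprime p-prime p∤b))
  ; f-*-∣       = shiftTotient-*-∣ L
  }

∣-<⇒≡0 : ∀ {p d} → d < p → p ∣ d → d ≡ 0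
∣-<⇒≡0 {d = zero}  _   _   = refl
∣-<⇒≡0 {d = suc d} d<p p∣d = ⊥-elim (<⇒≱ d<p (∣⇒≤ p∣d))

≡-mod-≤-<⇒≡ : ∀ {p x i j} → i ≤ j → j < p → p ∣ i + x → p ∣ j + x → i ≡ j
≡-mod-≤-<⇒≡ {p} {x} {i} {j} i≤j j<p p∣i+x p∣j+x = sym (begin
  j            ≡⟨ m+[n∸m]≡n i≤j ⟨
  i + (j ∸ i)  ≡⟨ cong (i +_) (∣-<⇒≡0 (≤-<-trans (m∸n≤m j i) j<p) p∣j∸i) ⟩
  i + 0        ≡⟨ +-identityʳ i ⟩
  i            ∎)
  where
  open ≡-Reasoning
  j+x≡i+x+[j∸i] : j + x ≡ i + x + (j ∸ i)
  j+x≡i+x+[j∸i] = trans (cong (_+ x) (sym (m+[n∸m]≡n i≤j))) (xy∙z≈xz∙y i (j ∸ i) x)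
  p∣j∸i : p ∣ j ∸ i
  p∣j∸i = ∣m+n∣m⇒∣n (subst (p ∣_) j+x≡i+x+[j∸i] p∣j+x) p∣i+x

≡-mod-<⇒≡ : ∀ {p x i j} → i < p → j < p → p ∣ i + x → p ∣ j + x → i ≡ j
≡-mod-<⇒≡ {i = i} {j} i<p j<p p∣i+x p∣j+x with ≤-total i j
... | inj₁ i≤j = ≡-mod-≤-<⇒≡ i≤j j<p p∣i+x p∣j+x
... | inj₂ j≤i = sym (≡-mod-≤-<⇒≡ j≤i i<p p∣j+x p∣i+x)

-- l ≢ l′ (mod p), phrased without subtraction
Incongruent : ℕ → ℕ → ℕ → Set
Incongruent p l l′ = ∀ u → p ∣ u + l → ¬ p ∣ u + l′

<⇒incongruent : ∀ {p i j} → i < j → j < p → Incongruent p i j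
<⇒incongruent {p} {i} {j} i<j j<p u p∣u+i p∣u+j = <⇒≢ i<j (≡-mod-<⇒≡ (<-trans i<j j<p) j<p
  (subst (p ∣_) (+-comm u i) p∣u+i) (subst (p ∣_) (+-comm u j) p∣u+j))

root : ∀ p .{{_ : NonZero p}} l → Σ[ u ∈ Fin p ] p ∣ toℕ u + l
root p l = fromℕ< (m%n<n x p) , subst (λ k → p ∣ k + l) (sym (toℕ-fromℕ< (m%n<n x p))) p∣x%p+l
  where
  open ≡-Reasoning
  x = p ∸ l % p
  p∣x+l : p ∣ x + l
  p∣x+l = divides (suc (l div p)) (begin
    x + l                        ≡⟨ cong (x +_) (m≡m%n+[m/n]*n l p) ⟩
    x + (l % p + l div p * p)    ≡⟨ +-assoc x (l % p) _ ⟨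
    x + l % p + l div p * p      ≡⟨ cong (_+ l div p * p) (m∸n+n≡m (<⇒≤ (m%n<n l p))) ⟩
    p + l div p * p              ∎)
  x+l≡[x/p]*p+[x%p+l] : x + l ≡ x div p * p + (x % p + l)
  x+l≡[x/p]*p+[x%p+l] = begin
    x + l                        ≡⟨ cong (_+ l) (m≡m%n+[m/n]*n x p) ⟩
    x % p + x div p * p + l      ≡⟨ xy∙z≈y∙xz (x % p) (x div p * p) l ⟩
    x div p * p + (x % p + l)    ∎
  p∣x%p+l : p ∣ x % p + l
  p∣x%p+l = ∣m+n∣m⇒∣n (subst (p ∣_) x+l≡[x/p]*p+[x%p+l] p∣x+l) (n∣m*n (x div p))

root-unique : ∀ {p l} (u v : Fin p) → p ∣ toℕ u + l → p ∣ toℕ v + l → u ≡ v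
root-unique u v p∣u+l p∣v+l = toℕ-injective (≡-mod-<⇒≡ (toℕ<n u) (toℕ<n v) p∣u+l p∣v+l)

-- Among y < p only the root u of y + l ≡ 0 loses the new factor, and y = u does satisfy the old shifts.
shiftTotient-∷ : ∀ {p l L} → Prime p → All (Incongruent p l) L →
                 shiftTotient L p ≡ suc (shiftTotient (l ∷ L) p)
shiftTotient-∷ {p} {l} {L} p-prime l-incongruent = begin
  Σ< p g              ≡⟨ +-identityʳ _ ⟨
  Σ< p g + 0          ≡⟨ cong (Σ< p g +_) f[u]≡0 ⟨
  Σ< p g + f (toℕ u)  ≡⟨ Σ<-agree-except {p} {f} {g} u f≡g-except-u ⟨
  Σ< p f + g (toℕ u)  ≡⟨ cong (Σ< p f +_) g[u]≡1 ⟩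
  Σ< p f + 1          ≡⟨ +-comm _ 1 ⟩
  suc (Σ< p f)        ∎
  where
  open ≡-Reasoning
  instance _ = prime⇒nonZero p-prime
  f g : ℕ → ℕ
  f y = 𝟙 (coprimeShifts? p (l ∷ L) y)
  g y = 𝟙 (coprimeShifts? p L y)
  u = proj₁ (root p l)
  p∣u+l = proj₂ (root p l)
  f[u]≡0 : f (toℕ u) ≡ 0
  f[u]≡0 = 𝟙-no (coprimeShifts? p (l ∷ L) (toℕ u)) λ { (c ∷ _) → coprime-prime⇒∤ p-prime c p∣u+l }
  coprime-u : ∀ {l′} → Incongruent p l l′ → Coprime (toℕ u + l′) p
  coprime-u l≢l′ = ∤-prime⇒coprime p-prime (l≢l′ (toℕ u) p∣u+l)
  g[u]≡1 : g (toℕ u) ≡ 1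
  g[u]≡1 = 𝟙-yes (coprimeShifts? p L (toℕ u)) (All.map coprime-u l-incongruent)
  f≡g-except-u : ∀ i → i ≢ u → f (toℕ i) ≡ g (toℕ i)
  f≡g-except-u i i≢u = begin
    f (toℕ i)                               ≡⟨ coprimeShifts-∷ p l L (toℕ i) ⟩
    𝟙 (coprime? (toℕ i + l) p) * g (toℕ i)  ≡⟨ cong (_* g (toℕ i)) (𝟙-yes (coprime? (toℕ i + l) p) coprime-i) ⟩
    1 * g (toℕ i)                           ≡⟨ *-identityˡ _ ⟩
    g (toℕ i)                               ∎
    where coprime-i = ∤-prime⇒coprime p-prime (λ p∣i+l → i≢u (root-unique i u p∣i+l p∣u+l))

shiftTotient-prime : ∀ {p L} → Prime p → AllPairs (Incongruent p) L → shiftTotient L p ≡ p ∸ length L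
shiftTotient-prime {p}         p-prime []                                 = trans (Σ<-const p 1) (*-identityʳ p)
shiftTotient-prime {p} {l ∷ L} p-prime (l-incongruent ∷ L-incongruent) = begin
  shiftTotient (l ∷ L) p   ≡⟨ cong pred (shiftTotient-∷ p-prime l-incongruent) ⟨
  pred (shiftTotient L p)  ≡⟨ cong pred (shiftTotient-prime p-prime L-incongruent) ⟩
  pred (p ∸ length L)      ≡⟨ pred[m∸n]≡m∸[1+n] p (length L) ⟩
  p ∸ suc (length L)       ∎
  where open ≡-Reasoning

shiftTotient-upTo-prime : ∀ {p} → Prime p → ∀ m → shiftTotient (upTo m) p ≡ p ∸ m
shiftTotient-upTo-prime {p} p-prime m with m ≤? p
... | yes m≤p = trans (shiftTotient-prime p-prime incongruent) (cong (p ∸_) (length-upTo m))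
  where incongruent = AllPairs.applyUpTo⁺₁ (λ i → i) m (λ i<j j<m → <⇒incongruent i<j (<-≤-trans j<m m≤p))
... | no m≰p = begin
  shiftTotient (upTo m) p  ≡⟨ Σ<-cong p (λ y → 𝟙-no (coprimeShifts? p (upTo m) y) (noCoprimeShifts y)) ⟩
  Σ< p (λ _ → 0)           ≡⟨ Σ<-const p 0 ⟩
  p * 0                    ≡⟨ *-zeroʳ p ⟩
  0                        ≡⟨ m≤n⇒m∸n≡0 (<⇒≤ (≰⇒> m≰p)) ⟨
  p ∸ m                    ∎
  where
  open ≡-Reasoning
  instance _ = prime⇒nonZero p-prime
  noCoprimeShifts : ∀ y → ¬ CoprimeShifts p (upTo m) y
  noCoprimeShifts y coprimeShifts = coprime-prime⇒∤ p-prime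
    (All.lookup coprimeShifts (∈-upTo⁺ (<-trans (toℕ<n u) (≰⇒> m≰p))))
    (subst (p ∣_) (+-comm (toℕ u) y) p∣u+y)
    where
    u = proj₁ (root p y)
    p∣u+y = proj₂ (root p y)

schemmel≡shiftTotient : ∀ m n → schemmel m n ≡ shiftTotient (upTo m) n
schemmel≡shiftTotient m n = begin
  schemmel m n
    ≡⟨ length-filter P? (map suc (upTo n)) ⟩
  sum (map (𝟙 ∘ P?) (map suc (upTo n)))
    ≡⟨ cong (sum ∘ map (𝟙 ∘ P?)) (map-applyUpTo (λ y → y) suc n) ⟩
  sum (map (𝟙 ∘ P?) (applyUpTo suc n))
    ≡⟨ cong sum (map-applyUpTo suc (𝟙 ∘ P?) n) ⟩
  sum (applyUpTo (𝟙 ∘ P? ∘ suc) n)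
    ≡⟨ sum-applyUpTo (𝟙 ∘ P? ∘ suc) n ⟩
  Σ< n (𝟙 ∘ P? ∘ suc)
    ≡⟨ Σ<-cong n (λ y → 𝟙-cong (P? (suc y)) (coprimeShifts? n (upTo m) (suc y)) to from) ⟩
  Σ< n (λ y → 𝟙 (coprimeShifts? n (upTo m) (suc y)))
    ≡⟨ Σ<-rotate (coprimeShifts-periodic n (upTo m)) ⟩
  shiftTotient (upTo m) n
    ∎
  where
  open ≡-Reasoning
  P? = λ k → Fin.all? {n = m} λ i → gcd (k + toℕ i) n ≟ 1
  to : ∀ {k} → (∀ (i : Fin m) → gcd (k + toℕ i) n ≡ 1) → CoprimeShifts n (upTo m) k
  to {k} h = All.applyUpTo⁺₁ (λ i → i) m coprime-below
    where
    coprime-below : ∀ {i} → i < m → Coprime (k + i) n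
    coprime-below i<m = gcd≡1⇒coprime (subst (λ j → gcd (k + j) n ≡ 1) (toℕ-fromℕ< i<m) (h (fromℕ< i<m)))
  from : ∀ {k} → CoprimeShifts n (upTo m) k → ∀ (i : Fin m) → gcd (k + toℕ i) n ≡ 1
  from coprimeShifts i = coprime⇒gcd≡1 (All.applyUpTo⁻ (λ i → i) m coprimeShifts (toℕ<n i))

Σˢ : ∀ n → (Subset n → ℕ) → ℕ
Σˢ zero    f = f []
Σˢ (suc n) f = Σˢ n (f ∘ (false ∷_)) + Σˢ n (f ∘ (true ∷_))

sum-allSubsets : ∀ n (f : Subset n → ℕ) → sum (map f (allSubsets n)) ≡ Σˢ n f
sum-allSubsets zero    f = +-identityʳ (f [])
sum-allSubsets (suc n) f = begin
  sum (map f (map (false ∷_) S ++ map (true ∷_) S))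
    ≡⟨ cong sum (map-++ f (map (false ∷_) S) _) ⟩
  sum (map f (map (false ∷_) S) ++ map f (map (true ∷_) S))
    ≡⟨ sum-++ (map f (map (false ∷_) S)) _ ⟩
  sum (map f (map (false ∷_) S)) + sum (map f (map (true ∷_) S))
    ≡⟨ cong₂ _+_ (cong sum (map-∘ S)) (cong sum (map-∘ S)) ⟨
  sum (map (f ∘ (false ∷_)) S) + sum (map (f ∘ (true ∷_)) S)
    ≡⟨ cong₂ _+_ (sum-allSubsets n (f ∘ (false ∷_))) (sum-allSubsets n (f ∘ (true ∷_))) ⟩
  Σˢ (suc n) f
    ∎
  where
  open ≡-Reasoning
  S = allSubsets n

Σˢ-cong : ∀ n {f g : Subset n → ℕ} → (∀ s → f s ≡ g s) → Σˢ n f ≡ Σˢ n g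
Σˢ-cong zero    f≗g = f≗g []
Σˢ-cong (suc n) f≗g = cong₂ _+_ (Σˢ-cong n (f≗g ∘ (false ∷_))) (Σˢ-cong n (f≗g ∘ (true ∷_)))

Σˢ-zero : ∀ n → Σˢ n (λ _ → 0) ≡ 0
Σˢ-zero zero    = refl
Σˢ-zero (suc n) = cong₂ _+_ (Σˢ-zero n) (Σˢ-zero n)

Σˢ-*ʳ : ∀ n k (f : Subset n → ℕ) → Σˢ n f * k ≡ Σˢ n (λ s → f s * k)
Σˢ-*ʳ zero    k f = refl
Σˢ-*ʳ (suc n) k f = trans (*-distribʳ-+ k (Σˢ n (f ∘ (false ∷_))) _)
                          (cong₂ _+_ (Σˢ-*ʳ n k (f ∘ (false ∷_))) (Σˢ-*ʳ n k (f ∘ (true ∷_))))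

Σˢ-∑ : ∀ n k (g : Subset n → Fin k → ℕ) → Σˢ n (λ s → ∑[ y < k ] g s y) ≡ ∑[ y < k ] Σˢ n (λ s → g s y)
Σˢ-∑ zero    k g = refl
Σˢ-∑ (suc n) k g = trans (cong₂ _+_ (Σˢ-∑ n k (g ∘ (false ∷_))) (Σˢ-∑ n k (g ∘ (true ∷_))))
                         (sym (∑-distrib-+ {k} _ _))

Σˢ-𝟙-empty : ∀ n → Σˢ n (λ s → 𝟙 (∣ s ∣ ≟ 0)) ≡ 1
Σˢ-𝟙-empty zero    = refl
Σˢ-𝟙-empty (suc n) = cong₂ _+_ (Σˢ-𝟙-empty n) (Σˢ-zero n)

∣s∣≡0⇒∉ : ∀ {n} (s : Subset n) {i} → ∣ s ∣ ≡ 0 → i ∉ s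
∣s∣≡0⇒∉ (false ∷ s) ∣s∣≡0 (there i∈s) = ∣s∣≡0⇒∉ s ∣s∣≡0 i∈s

∣s∣≡∑𝟙∈ : ∀ {n} (s : Subset n) → ∣ s ∣ ≡ ∑[ y < n ] 𝟙 (y ∈? s)
∣s∣≡∑𝟙∈ []          = refl
∣s∣≡∑𝟙∈ (true ∷ s)  = cong suc (∣s∣≡∑𝟙∈ s)
∣s∣≡∑𝟙∈ (false ∷ s) = ∣s∣≡∑𝟙∈ s

toggle : ∀ {n} → Fin n → Subset n → Subset n
toggle zero    (b ∷ s) = not b ∷ s
toggle (suc y) (b ∷ s) = b ∷ toggle y s

Σˢ-toggle : ∀ n (y : Fin n) (f : Subset n → ℕ) → Σˢ n f ≡ Σˢ n (f ∘ toggle y)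
Σˢ-toggle (suc n) zero    f = +-comm (Σˢ n (f ∘ (false ∷_))) _
Σˢ-toggle (suc n) (suc y) f = cong₂ _+_ (Σˢ-toggle n y (f ∘ (false ∷_))) (Σˢ-toggle n y (f ∘ (true ∷_)))

∈-toggle : ∀ {n} (y : Fin n) s → y ∉ s → y ∈ toggle y s
∈-toggle zero    (true ∷ s)  y∉s = ⊥-elim (y∉s here)
∈-toggle zero    (false ∷ s) _   = here
∈-toggle (suc y) (b ∷ s)     y∉s = there (∈-toggle y s (y∉s ∘ there))

∉-toggle : ∀ {n} (y : Fin n) s → y ∈ s → y ∉ toggle y s
∉-toggle zero    (true ∷ s) _           ()
∉-toggle (suc y) (b ∷ s)    (there y∈s) (there y∈t) = ∉-toggle y s y∈s y∈t

∈-toggle-≢⁻ : ∀ {n} {x : Fin n} y s → x ≢ y → x ∈ toggle y s → x ∈ s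
∈-toggle-≢⁻ {x = zero}  zero    s       x≢y _           = ⊥-elim (x≢y refl)
∈-toggle-≢⁻ {x = zero}  (suc y) (b ∷ s) _   here        = here
∈-toggle-≢⁻ {x = suc x} zero    (b ∷ s) _   (there x∈t) = there x∈t
∈-toggle-≢⁻ {x = suc x} (suc y) (b ∷ s) x≢y (there x∈t) = there (∈-toggle-≢⁻ y s (x≢y ∘ cong suc) x∈t)

∈-toggle-≢⁺ : ∀ {n} {x : Fin n} y s → x ≢ y → x ∈ s → x ∈ toggle y s
∈-toggle-≢⁺ {x = zero}  zero    s       x≢y _           = ⊥-elim (x≢y refl)
∈-toggle-≢⁺ {x = zero}  (suc y) (b ∷ s) _   here        = here
∈-toggle-≢⁺ {x = suc x} zero    (b ∷ s) _   (there x∈s) = there x∈s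
∈-toggle-≢⁺ {x = suc x} (suc y) (b ∷ s) x≢y (there x∈s) = there (∈-toggle-≢⁺ y s (x≢y ∘ cong suc) x∈s)

∣toggle∣ : ∀ {n} (y : Fin n) s → y ∉ s → ∣ toggle y s ∣ ≡ suc ∣ s ∣
∣toggle∣ zero    (true ∷ s)  y∉s = ⊥-elim (y∉s here)
∣toggle∣ zero    (false ∷ s) _   = refl
∣toggle∣ (suc y) (true ∷ s)  y∉s = cong suc (∣toggle∣ y s (y∉s ∘ there))
∣toggle∣ (suc y) (false ∷ s) y∉s = ∣toggle∣ y s (y∉s ∘ there)

members : ∀ {n} → Subset n → List (Fin n)
members []          = []
members (true ∷ s)  = zero ∷ map suc (members s)
members (false ∷ s) = map suc (members s)

length-members : ∀ {n} (s : Subset n) → length (members s) ≡ ∣ s ∣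
length-members []          = refl
length-members (true ∷ s)  = cong suc (trans (length-map suc (members s)) (length-members s))
length-members (false ∷ s) = trans (length-map suc (members s)) (length-members s)

All-members⁺ : ∀ {n p} {P : Fin n → Set p} s → (∀ c → c ∈ s → P c) → All P (members s)
All-members⁺ []          _ = []
All-members⁺ (true ∷ s)  h = h zero here ∷ All.map⁺ (All-members⁺ s (λ c → h (suc c) ∘ there))
All-members⁺ (false ∷ s) h = All.map⁺ (All-members⁺ s (λ c → h (suc c) ∘ there))

All-members⁻ : ∀ {n p} {P : Fin n → Set p} s → All P (members s) → ∀ c → c ∈ s → P c
All-members⁻ (true ∷ s)  (pz ∷ _) zero    here        = pz
All-members⁻ (true ∷ s)  (_ ∷ ps) (suc c) (there c∈s) = All-members⁻ s (All.map⁻ ps) c c∈s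
All-members⁻ (false ∷ s) ps       (suc c) (there c∈s) = All-members⁻ s (All.map⁻ ps) c c∈s

AllPairs-members⁺ : ∀ {n r} {R : Fin n → Fin n → Set r} s →
                    (∀ c c′ → c ≢ c′ → c ∈ s → c′ ∈ s → R c c′) → AllPairs R (members s)
AllPairs-suc-members⁺ : ∀ {n r} {R : Fin (suc n) → Fin (suc n) → Set r} b s →
                        (∀ c c′ → c ≢ c′ → c ∈ b ∷ s → c′ ∈ b ∷ s → R c c′) → AllPairs R (map suc (members s))

AllPairs-members⁺ []          _ = []
AllPairs-members⁺ (true ∷ s)  h =
  All.map⁺ (All-members⁺ s (λ c′ → h zero (suc c′) (λ ()) here ∘ there)) ∷ AllPairs-suc-members⁺ true s h
AllPairs-members⁺ (false ∷ s) h = AllPairs-suc-members⁺ false s h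

AllPairs-suc-members⁺ b s h = AllPairs.map⁺ (AllPairs-members⁺ s λ c c′ c≢c′ c∈s c′∈s →
  h (suc c) (suc c′) (c≢c′ ∘ Fin.suc-injective) (there c∈s) (there c′∈s))

module CliqueCounting {n : ℕ} {R : Fin n → Fin n → Set} (R? : ∀ i j → Dec (R i j)) where

  IsClique : Subset n → Set
  IsClique s = ∀ i j → i ≢ j → i ∈ s → j ∈ s → R i j

  CommonNeighbour : Subset n → Fin n → Set
  CommonNeighbour s y = ∀ c → c ∈ s → R y c

  commonNeighbour? : ∀ s y → Dec (CommonNeighbour s y)
  commonNeighbour? s y = Fin.all? λ c → (c ∈? s) →-dec R? y c

  extend-clique : (∀ {i j} → R i j → R j i) →
                  ∀ {y s} → y ∉ s → IsClique s → CommonNeighbour s y → IsClique (toggle y s)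
  extend-clique R-sym {y} {s} y∉s clique common i j i≢j i∈t j∈t with i Fin.≟ y | j Fin.≟ y
  ... | yes refl | yes refl = ⊥-elim (i≢j refl)
  ... | yes refl | no j≢y   = common j (∈-toggle-≢⁻ y s j≢y j∈t)
  ... | no i≢y   | yes refl = R-sym (common i (∈-toggle-≢⁻ y s i≢y i∈t))
  ... | no i≢y   | no j≢y   = clique i j i≢j (∈-toggle-≢⁻ y s i≢y i∈t) (∈-toggle-≢⁻ y s j≢y j∈t)

  restrict-clique : ∀ {y s} → y ∉ s → IsClique (toggle y s) → IsClique s × CommonNeighbour s y
  restrict-clique {y} {s} y∉s clique =
      (λ i j i≢j i∈s j∈s → clique i j i≢j (∈-toggle-≢⁺ y s (≢y i∈s) i∈s) (∈-toggle-≢⁺ y s (≢y j∈s) j∈s))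
    , (λ c c∈s → clique y c (≢y c∈s ∘ sym) (∈-toggle y s y∉s) (∈-toggle-≢⁺ y s (≢y c∈s) c∈s))
    where
    ≢y : ∀ {i} → i ∈ s → i ≢ y
    ≢y i∈s refl = y∉s i∈s

  module Counting (clique? : ∀ m s → Dec (∣ s ∣ ≡ m × IsClique s)) where

    cliqueCount : ℕ → ℕ
    cliqueCount m = Σˢ n (𝟙 ∘ clique? m)

    cliqueCount-0 : cliqueCount 0 ≡ 1
    cliqueCount-0 = trans (Σˢ-cong n (λ s → 𝟙-cong (clique? 0 s) (∣ s ∣ ≟ 0) proj₁ (emptyClique s)))
                          (Σˢ-𝟙-empty n)
      where
      emptyClique : ∀ s → ∣ s ∣ ≡ 0 → ∣ s ∣ ≡ 0 × IsClique s
      emptyClique s ∣s∣≡0 = ∣s∣≡0 , λ i _ _ i∈s _ → ⊥-elim (∣s∣≡0⇒∉ s ∣s∣≡0 i∈s)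

    module _ (R-sym : ∀ {i j} → R i j → R j i) (R-irrefl : ∀ i → ¬ R i i) where

      -- Toggling y matches the (m + 1)-cliques containing y with the m-cliques not containing y
      -- of which y is a common neighbour.
      toggle-weight : ∀ m y s → 𝟙 (y ∈? toggle y s) * 𝟙 (clique? (suc m) (toggle y s)) ≡
                                𝟙 (clique? m s) * 𝟙 (commonNeighbour? s y)
      toggle-weight m y s with y ∈? s
      ... | yes y∈s = begin
        𝟙 (y ∈? toggle y s) * Q′
          ≡⟨ cong (_* Q′) (𝟙-no (y ∈? toggle y s) (∉-toggle y s y∈s)) ⟩
        0
          ≡⟨ *-zeroʳ (𝟙 (clique? m s)) ⟨
        𝟙 (clique? m s) * 0
          ≡⟨ cong (𝟙 (clique? m s) *_) (𝟙-no (commonNeighbour? s y) λ common → R-irrefl y (common y y∈s)) ⟨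
        𝟙 (clique? m s) * 𝟙 (commonNeighbour? s y)
          ∎
        where
        open ≡-Reasoning
        Q′ = 𝟙 (clique? (suc m) (toggle y s))
      ... | no y∉s = begin
        𝟙 (y ∈? toggle y s) * Q′
          ≡⟨ cong (_* Q′) (𝟙-yes (y ∈? toggle y s) (∈-toggle y s y∉s)) ⟩
        1 * Q′
          ≡⟨ *-identityˡ Q′ ⟩
        Q′
          ≡⟨ 𝟙-× (clique? m s) (commonNeighbour? s y) (clique? (suc m) (toggle y s)) restrict extend ⟩
        𝟙 (clique? m s) * 𝟙 (commonNeighbour? s y)
          ∎
        where
        open ≡-Reasoning
        Q′ = 𝟙 (clique? (suc m) (toggle y s))
        restrict : ∣ toggle y s ∣ ≡ suc m × IsClique (toggle y s) →
                   (∣ s ∣ ≡ m × IsClique s) × CommonNeighbour s y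
        restrict (size , clique) =
          let (s-clique , common) = restrict-clique y∉s clique
          in (suc-injective (trans (sym (∣toggle∣ y s y∉s)) size) , s-clique) , common
        extend : ∣ s ∣ ≡ m × IsClique s → CommonNeighbour s y →
                 ∣ toggle y s ∣ ≡ suc m × IsClique (toggle y s)
        extend (size , clique) common =
          trans (∣toggle∣ y s y∉s) (cong suc size) , extend-clique R-sym y∉s clique common

      cliqueCount-suc : ∀ m N → (∀ s → ∣ s ∣ ≡ m → IsClique s → ∑[ y < n ] 𝟙 (commonNeighbour? s y) ≡ N) →
                        cliqueCount (suc m) * suc m ≡ cliqueCount m * N
      cliqueCount-suc m N commonNeighbours = begin
        cliqueCount (suc m) * suc m
          ≡⟨ Σˢ-*ʳ n (suc m) (Q (suc m)) ⟩
        Σˢ n (λ s → Q (suc m) s * suc m)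
          ≡⟨ Σˢ-cong n size-weight ⟩
        Σˢ n (λ s → ∣ s ∣ * Q (suc m) s)
          ≡⟨ Σˢ-cong n (λ s → trans (cong (_* Q (suc m) s) (∣s∣≡∑𝟙∈ s)) (*-distribʳ-sum {n} (Q (suc m) s) _)) ⟩
        Σˢ n (λ s → ∑[ y < n ] (𝟙 (y ∈? s) * Q (suc m) s))
          ≡⟨ Σˢ-∑ n n _ ⟩
        ∑[ y < n ] Σˢ n (λ s → 𝟙 (y ∈? s) * Q (suc m) s)
          ≡⟨ sum-cong-≗ {n} (λ y → Σˢ-toggle n y _) ⟩
        ∑[ y < n ] Σˢ n (λ s → 𝟙 (y ∈? toggle y s) * Q (suc m) (toggle y s))
          ≡⟨ sum-cong-≗ {n} (λ y → Σˢ-cong n (toggle-weight m y)) ⟩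
        ∑[ y < n ] Σˢ n (λ s → Q m s * E s y)
          ≡⟨ Σˢ-∑ n n _ ⟨
        Σˢ n (λ s → ∑[ y < n ] (Q m s * E s y))
          ≡⟨ Σˢ-cong n (λ s → *-distribˡ-sum {n} (Q m s) (E s)) ⟨
        Σˢ n (λ s → Q m s * ∑[ y < n ] E s y)
          ≡⟨ Σˢ-cong n clique-weight ⟩
        Σˢ n (λ s → Q m s * N)
          ≡⟨ Σˢ-*ʳ n N (Q m) ⟨
        cliqueCount m * N
          ∎
        where
        open ≡-Reasoning
        Q : ℕ → Subset n → ℕ
        Q m s = 𝟙 (clique? m s)
        E : Subset n → Fin n → ℕ
        E s y = 𝟙 (commonNeighbour? s y)
        size-weight : ∀ s → Q (suc m) s * suc m ≡ ∣ s ∣ * Q (suc m) s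
        size-weight s with clique? (suc m) s
        ... | yes (size , _) = trans (+-identityʳ (suc m)) (trans (sym size) (sym (*-identityʳ ∣ s ∣)))
        ... | no _           = sym (*-zeroʳ ∣ s ∣)
        clique-weight : ∀ s → Q m s * ∑[ y < n ] E s y ≡ Q m s * N
        clique-weight s with clique? m s
        ... | yes (size , clique) = cong (1 *_) (commonNeighbours s size clique)
        ... | no _                = refl

[d*[c%n]]%n≡[d*c]%n : ∀ d c n .{{_ : NonZero n}} → (d * (c % n)) % n ≡ (d * c) % n
[d*[c%n]]%n≡[d*c]%n d c n = begin
  (d * (c % n)) % n            ≡⟨ %-distribˡ-* d (c % n) n ⟩
  ((d % n) * (c % n % n)) % n  ≡⟨ cong (λ k → ((d % n) * k) % n) (m%n%n≡m%n c n) ⟩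
  ((d % n) * (c % n)) % n      ≡⟨ %-distribˡ-* d c n ⟨
  (d * c) % n                  ∎
  where open ≡-Reasoning

isUnit⇒coprime : ∀ n .{{_ : NonZero n}} {d} → IsUnit n d → Coprime d n
isUnit⇒coprime n (c , dc≡1) (e∣d , e∣n) =
  ∣1⇒≡1 (∣n∣m%n⇒∣m e∣n (subst (_ ∣_) dc≡1 (%-presˡ-∣ (∣m⇒∣m*n (toℕ c) e∣d) e∣n)))

inverse⇒isUnit : ∀ n .{{_ : NonZero n}} d c → (d * c) % n ≡ 1 % n → IsUnit n d
inverse⇒isUnit n d c dc≡1 = fromℕ< (m%n<n c n) ,
  trans (cong (λ k → (d * k) % n) (toℕ-fromℕ< (m%n<n c n))) (trans ([d*[c%n]]%n≡[d*c]%n d c n) dc≡1)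

coprime⇒isUnit : ∀ n .{{_ : NonZero n}} {d} → Coprime d n → IsUnit n d
coprime⇒isUnit n {d} coprime with coprime-Bézout coprime
... | Bézout.+- x y 1+yn≡xd = inverse⇒isUnit n d x (begin
  (d * x) % n      ≡⟨ cong (_% n) (trans (*-comm d x) (sym 1+yn≡xd)) ⟩
  (1 + y * n) % n  ≡⟨ [m+kn]%n≡m%n 1 y n ⟩
  1 % n            ∎)
  where open ≡-Reasoning
-- Here d x ≡ −1 (mod n), so (n − 1) x is an inverse of d.
coprime⇒isUnit n@(suc n-1) {d} coprime | Bézout.-+ x y 1+xd≡yn = inverse⇒isUnit n d (n-1 * x) (begin
  (d * (n-1 * x)) % n          ≡⟨ [m+kn]%n≡m%n (d * (n-1 * x)) 1 n ⟨
  (d * (n-1 * x) + 1 * n) % n  ≡⟨ cong (_% n) (begin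
      d * (n-1 * x) + 1 * n      ≡⟨ rearrange d n-1 x ⟩
      1 + n-1 * (1 + x * d)      ≡⟨ cong (λ k → 1 + n-1 * k) 1+xd≡yn ⟩
      1 + n-1 * (y * n)          ≡⟨ cong (1 +_) (*-assoc n-1 y n) ⟨
      1 + n-1 * y * n            ∎) ⟩
  (1 + n-1 * y * n) % n        ≡⟨ [m+kn]%n≡m%n 1 (n-1 * y) n ⟩
  1 % n                        ∎)
  where
  open ≡-Reasoning
  rearrange : ∀ d n-1 x → d * (n-1 * x) + 1 * suc n-1 ≡ 1 + n-1 * (1 + x * d)
  rearrange = solve-∀

-- toℕ a + (n ∸ toℕ b) represents a − b; Defs.diffMod reduces it modulo n.
module _ (n : ℕ) .{{_ : NonZero n}} where

  adj⇒coprime : ∀ a b → Adj n a b → Coprime (toℕ a + (n ∸ toℕ b)) n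
  adj⇒coprime a b adj (e∣z , e∣n) = isUnit⇒coprime n adj (%-presˡ-∣ e∣z e∣n , e∣n)

  coprime⇒adj : ∀ a b → Coprime (toℕ a + (n ∸ toℕ b)) n → Adj n a b
  coprime⇒adj a b coprime = coprime⇒isUnit n λ (e∣z%n , e∣n) → coprime (∣n∣m%n⇒∣m e∣n e∣z%n , e∣n)

  adj-sym : ∀ a b → Adj n a b → Adj n b a
  adj-sym a b adj = coprime⇒adj b a λ {e} (e∣b-a , e∣n) →
    adj⇒coprime a b adj (∣m+n∣m⇒∣n (subst (e ∣_) differences-sum (∣m∣n⇒∣m+n e∣n e∣n)) e∣b-a , e∣n)
    where
    swap-tails : ∀ w x y z → (w + x) + (y + z) ≡ (w + z) + (y + x)
    swap-tails = solve-∀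
    differences-sum : n + n ≡ (toℕ b + (n ∸ toℕ a)) + (toℕ a + (n ∸ toℕ b))
    differences-sum = trans (sym (cong₂ _+_ (m+[n∸m]≡n (<⇒≤ (toℕ<n b))) (m+[n∸m]≡n (<⇒≤ (toℕ<n a)))))
                            (swap-tails (toℕ b) (n ∸ toℕ b) (toℕ a) (n ∸ toℕ a))

  adj-irrefl : 1 < n → ∀ a → ¬ Adj n a a
  adj-irrefl 1<n a adj =
    <⇒≢ 1<n (sym (adj⇒coprime a a adj (subst (n ∣_) (sym (m+[n∸m]≡n (<⇒≤ (toℕ<n a)))) ∣-refl , ∣-refl)))

  adj⇒incongruent : ∀ {p} → Prime p → p ∣ n → ∀ a b → Adj n a b → Incongruent p (n ∸ toℕ a) (n ∸ toℕ b)
  adj⇒incongruent {p} p-prime p∣n a b adj u p∣u+[n-a] p∣u+[n-b] =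
    nonTrivial⇒≢1 {{prime⇒nonTrivial p-prime}} (adj⇒coprime a b adj (p∣a+[n-b] , p∣n))
    where
    rearrange : ∀ u x a y → (u + x) + (a + y) ≡ (u + y) + (x + a)
    rearrange = solve-∀
    sum≡ : (u + (n ∸ toℕ a)) + (toℕ a + (n ∸ toℕ b)) ≡ (u + (n ∸ toℕ b)) + n
    sum≡ = trans (rearrange u (n ∸ toℕ a) (toℕ a) (n ∸ toℕ b))
                 (cong (u + (n ∸ toℕ b) +_) (m∸n+n≡m (<⇒≤ (toℕ<n a))))
    p∣a+[n-b] : p ∣ toℕ a + (n ∸ toℕ b)
    p∣a+[n-b] = ∣m+n∣m⇒∣n (subst (p ∣_) (sym sum≡) (∣m∣n⇒∣m+n p∣u+[n-b] p∣n)) p∣u+[n-a]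

  open CliqueCounting (λ i j → isUnit? n (diffMod n i j))
  open Counting (isCliqueOfOrder? n)

  shifts : Subset n → List ℕ
  shifts s = map (λ c → n ∸ toℕ c) (members s)

  commonNeighbourCount : ∀ m s → ∣ s ∣ ≡ m → IsClique s → ∑[ y < n ] 𝟙 (commonNeighbour? s y) ≡ schemmel m n
  commonNeighbourCount m s size clique = begin
    ∑[ y < n ] 𝟙 (commonNeighbour? s y)
      ≡⟨ sum-cong-≗ {n} (λ y → 𝟙-cong (commonNeighbour? s y) (coprimeShifts? n (shifts s) (toℕ y)) to from) ⟩
    shiftTotient (shifts s) n
      ≡⟨ totientLike-unique (shiftTotient-totientLike (shifts s)) (shiftTotient-totientLike (upTo m)) n agree ⟩
    shiftTotient (upTo m) n
      ≡⟨ schemmel≡shiftTotient m n ⟨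
    schemmel m n
      ∎
    where
    open ≡-Reasoning
    to : ∀ {y} → CommonNeighbour s y → CoprimeShifts n (shifts s) (toℕ y)
    to {y} common = All.map⁺ (All-members⁺ s (λ c c∈s → adj⇒coprime y c (common c c∈s)))
    from : ∀ {y} → CoprimeShifts n (shifts s) (toℕ y) → CommonNeighbour s y
    from {y} coprimeShifts c c∈s = coprime⇒adj y c (All-members⁻ s (All.map⁻ coprimeShifts) c c∈s)
    agree : ∀ p → Prime p → p ∣ n → shiftTotient (shifts s) p ≡ shiftTotient (upTo m) p
    agree p p-prime p∣n = begin
      shiftTotient (shifts s) p  ≡⟨ shiftTotient-prime p-prime incongruent ⟩
      p ∸ length (shifts s)      ≡⟨ cong (p ∸_) (trans (length-map _ (members s)) (length-members s)) ⟩
      p ∸ ∣ s ∣                  ≡⟨ cong (p ∸_) size ⟩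
      p ∸ m                      ≡⟨ shiftTotient-upTo-prime p-prime m ⟨
      shiftTotient (upTo m) p    ∎
      where
      incongruent : AllPairs (Incongruent p) (shifts s)
      incongruent = AllPairs.map⁺ (AllPairs-members⁺ s λ a b a≢b a∈s b∈s →
        adj⇒incongruent p-prime p∣n a b (clique a b a≢b a∈s b∈s))

  numCliques≡cliqueCount : ∀ m → numCliques n m ≡ cliqueCount m
  numCliques≡cliqueCount m = trans (length-filter (isCliqueOfOrder? n m) (allSubsets n))
                                   (sum-allSubsets n (𝟙 ∘ isCliqueOfOrder? n m))

  numCliques-0 : numCliques n 0 ≡ 1
  numCliques-0 = trans (numCliques≡cliqueCount 0) cliqueCount-0

  numCliques-suc : 1 < n → ∀ m → numCliques n (suc m) * suc m ≡ numCliques n m * schemmel m n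
  numCliques-suc 1<n m = begin
    numCliques n (suc m) * suc m   ≡⟨ cong (_* suc m) (numCliques≡cliqueCount (suc m)) ⟩
    cliqueCount (suc m) * suc m    ≡⟨ cliqueCount-suc (λ {a} {b} → adj-sym a b) (adj-irrefl 1<n)
                                                      m (schemmel m n) (commonNeighbourCount m) ⟩
    cliqueCount m * schemmel m n   ≡⟨ cong (_* schemmel m n) (numCliques≡cliqueCount m) ⟨
    numCliques n m * schemmel m n  ∎
    where open ≡-Reasoning

-- Imported only here: Data.Integer's prefix +_ makes sections such as (f 0 +_) above ambiguous.
open import Data.Integer using (+_)
import Data.Integer as ℤ
import Data.Integer.Properties as ℤ
open import Data.Rational using (_/_; toℚᵘ) renaming (_*_ to _*ℚ_)
open import Data.Rational.Properties using (toℚᵘ-injective; toℚᵘ-fromℚᵘ; toℚᵘ-homo-*)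
open import Data.Rational.Unnormalised using (mkℚᵘ; *≡*) renaming (_*_ to _*ᵘ_)
import Data.Rational.Unnormalised.Properties as ℚᵘ

a/1*b/[1+c]≡d/1 : ∀ a b c d → d * suc c ≡ a * b → (+ a / 1) *ℚ (+ b / suc c) ≡ + d / 1
a/1*b/[1+c]≡d/1 a b c d d[1+c]≡ab = toℚᵘ-injective (begin
  toℚᵘ ((+ a / 1) *ℚ (+ b / suc c))     ≈⟨ toℚᵘ-homo-* (+ a / 1) (+ b / suc c) ⟩
  toℚᵘ (+ a / 1) *ᵘ toℚᵘ (+ b / suc c)  ≈⟨ ℚᵘ.*-cong (toℚᵘ-fromℚᵘ (mkℚᵘ (+ a) 0)) (toℚᵘ-fromℚᵘ (mkℚᵘ (+ b) c)) ⟩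
  mkℚᵘ (+ a) 0 *ᵘ mkℚᵘ (+ b) c          ≈⟨ *≡* cross-multiplied ⟩
  mkℚᵘ (+ d) 0                          ≈⟨ toℚᵘ-fromℚᵘ (mkℚᵘ (+ d) 0) ⟨
  toℚᵘ (+ d / 1)                        ∎)
  where
  open ℚᵘ.≃-Reasoning
  cross-multiplied : (+ a ℤ.* + b) ℤ.* + 1 ≡ + d ℤ.* + (1 * suc c)
  cross-multiplied = trans (ℤ.*-identityʳ _) (trans (sym (ℤ.pos-* a b))
    (trans (cong +_ (trans (sym d[1+c]≡ab) (cong (d *_) (sym (*-identityˡ (suc c)))))) (ℤ.pos-* d (1 * suc c))))

corollary3p2 : (m n : ℕ) .{{_ : NonZero n}} → 0 < m → 1 < n →
    (+ numCliques n m) / 1 ≡ schemmelProduct m n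
corollary3p2 m n _ 1<n = count≡product m
  where
  count≡product : ∀ m → (+ numCliques n m) / 1 ≡ schemmelProduct m n
  count≡product zero    = cong (λ k → + k / 1) (numCliques-0 n)
  count≡product (suc m) = begin
    + numCliques n (suc m) / 1                          ≡⟨ a/1*b/[1+c]≡d/1 (numCliques n m) (schemmel m n) m
                                                             (numCliques n (suc m)) (numCliques-suc n 1<n m) ⟨
    (+ numCliques n m / 1) *ℚ (+ schemmel m n / suc m)  ≡⟨ cong (_*ℚ (+ schemmel m n / suc m)) (count≡product m) ⟩
    schemmelProduct (suc m) n                           ∎
    where open ≡-Reasoning
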